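{- Let $k\ge1$ be fixed and let $(B_1,\dots,B_k)$ be a simple sequence of subsets of $[n]$. Then for all $\underline{x}\in\{0,1\}^k$, \[ |I_{\underline{x}}|=\frac{n}{2^k}\left(1\pm4^k\sqrt{\frac{\log n}{n}}\right). \]
   Context: $J_1=\{\ell\in\mathbb{Z}: n/2-\sqrt{n\log n}\le\ell\le n/2+\sqrt{n\log n}\}$. A sequence $(B_1,\dots,B_k)$ of subsets of $[n]$ (row index sets of dependencies of a matrix) is simple if for every nonempty $\{j_1<\dots<j_l\}\subseteq[k]$ the symmetric difference $B_{j_1}\oplus\cdots\oplus B_{j_l}$ has size in $J_1$. For $\underline{x}\in\{0,1\}^k$, $I_{\underline{x}}=\bigcap_{i=1}^kB_i^{(x_i)}$, where $B_i^{(1)}=B_i$ and $B_i^{(0)}=[n]\setminus B_i$. The notation $a=b(1\pm c)$ means $|a-b|\le bc$ (for $n$ large). -}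

module Defs where

open import Data.Nat using (ℕ; zero; suc; _+_; _*_; _^_; _≤_; _!; ∣_-_∣)
open import Data.Nat.DivMod using (_/_)
open import Data.Nat.Properties using (_!≢0)
open import Data.List using (map; upTo)
open import Data.Nat.ListAction using (sum)
open import Data.Bool using (Bool; true; false; _xor_; _∧_; not)
open import Data.Fin using (Fin; zero; suc)
open import Data.Fin.Subset using (Subset; Nonempty; ∣_∣)
open import Data.Vec using (tabulate; lookup)

-- ∑_{j=0}^{m} a^j · (m! / j!)   (each m!/j! is an exact natural number)
-- This is m! times the m-th partial sum of the exponential series for e^a.
expScaled : ℕ → ℕ → ℕ
expScaled a m = sum (map (λ j → a ^ j * ((m !) / (j !)) {{j !≢0}}) (upTo (suc m)))

-- LeMulLog a b n  encodes the real inequality  a ≤ b · ln n  (natural log).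
-- Since e^a = sup_m ∑_{j≤m} a^j/j!, we have e^a ≤ n^b  iff  for all m,
-- ∑_{j≤m} a^j/j! ≤ n^b, i.e. (multiplying by m!) expScaled a m ≤ n^b · m!.
-- For b ≥ 1 and n ≥ 1 this is equivalent to  a ≤ b · ln n.
LeMulLog : ℕ → ℕ → ℕ → Set
LeMulLog a b n = ∀ m → expScaled a m ≤ n ^ b * (m !)

-- ℓ ∈ J₁(n)  iff  |ℓ - n/2| ≤ √(n ln n)  iff  |2ℓ - n|² ≤ 4 n ln n
InJ₁ : ℕ → ℕ → Set
InJ₁ n ℓ = LeMulLog (∣ 2 * ℓ - n ∣ ^ 2) (4 * n) n

xorFold : ∀ {k n} → Subset k → (Fin k → Subset n) → Fin n → Bool
xorFold {zero}  S B i = false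
xorFold {suc k} S B i =
  (lookup S zero ∧ lookup (B zero) i) xor xorFold {k} (tabulate (λ j → lookup S (suc j))) (λ j → B (suc j)) i

symDiff : ∀ {k n} → Subset k → (Fin k → Subset n) → Subset n
symDiff S B = tabulate (xorFold S B)

Simple : ∀ {k n} → (Fin k → Subset n) → Set
Simple {k} {n} B = ∀ (S : Subset k) → Nonempty S → InJ₁ n ∣ symDiff S B ∣

-- membership of i in B^{(x)}: B itself if x = 1 (true), complement if x = 0 (false)
memAll : ∀ {k n} → (Fin k → Subset n) → (Fin k → Bool) → Fin n → Bool
memAll {zero}  B x i = true
memAll {suc k} B x i =
  not (lookup (B zero) i xor x zero) ∧ memAll {k} (λ j → B (suc j)) (λ j → x (suc j)) i

Ix : ∀ {k n} → (Fin k → Subset n) → (Fin k → Bool) → Subset n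
Ix B x = tabulate (memAll B x)

-- Write b⁽ⁱ⁾ ∈ 𝔽₂ᵏ for the positions where row i disagrees with x, b⁽ⁱ⁾ⱼ = [i ∈ B_j] ⊕ x_j, so that
-- i ∈ I_x iff b⁽ⁱ⁾ = 0. Orthogonality of characters, ∑_S (-1)^(S·b) = 2ᵏ [b = 0], summed over the
-- rows gives 2ᵏ |I_x| - n = ∑_{S ≠ ∅} ±(n - 2 |B_S|), where B_S = ⊕_{j ∈ S} B_j, and simplicity
-- bounds every one of these terms by 2 √(n ln n). Adding them up along the binary tree of subsets
-- with (a + b)² ≤ 4 max(a, b)² gives |2ᵏ |I_x| - n|² ≤ 4ᵏ · 4 n ln n ≤ 16ᵏ n ln n, as k ≥ 1.
-- Encoded as e^a ≤ n^b through the truncated exponential series, the relation a ≤ b ln n is additive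
-- in (a, b) because the truncation is submultiplicative, m! E_m(a + b) ≤ E_m(a) E_m(b), by the
-- binomial theorem.

{-# OPTIONS --safe #-}
module Submission where

open import Data.Bool using (Bool; true; false; not; _∧_; _xor_)
open import Data.Bool.Properties using (not-involutive; xor-comm; xor-identityʳ; xor-∧-commutativeRing)
open import Data.Fin using (Fin; zero; suc; toℕ)
open import Data.Fin.Properties using (toℕ≤pred[n])
open import Data.Fin.Subset using (Subset; Nonempty; ∣_∣; ⊥; inside; outside)
open import Data.List.Base using (applyUpTo) renaming (map to mapᴸ)
open import Data.Nat
open import Data.Nat.Combinatorics using (_C_; nCk≡n!/k![n-k]!; k![n∸k]!∣n!)
open import Data.Nat.Divisibility using (m≤n⇒m!∣n!)
open import Data.Nat.DivMod using (_/_; m/n*n≡m; n/1≡n)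
open import Data.Nat.ListAction using () renaming (sum to sumᴸ)
open import Data.Nat.Properties
open import Data.Nat.Tactic.RingSolver using (solve-∀)
open import Data.Product using (_,_; ∃-syntax)
open import Data.Sum using (inj₁; inj₂)
open import Data.Vec using (_∷_; []; tabulate; lookup; here; there)
open import Data.Vec.Properties using (tabulate∘lookup)
open import Data.Vec.Functional using (Vector)
open import Function using (_∘_)
open import Relation.Binary.PropositionalEquality
open import Algebra.Bundles using (CommutativeRing)
open import Algebra.Properties.CommutativeSemigroup
  (CommutativeRing.+-commutativeSemigroup xor-∧-commutativeRing)
  using () renaming (interchange to xor-interchange)

open import Algebra.Properties.Semiring.Sum +-*-semiring
  using ( sum; sum-syntax; sum-cong-≗; ∑-distrib-+; *-distribˡ-sum; *-distribʳ-sum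
        ; sum-replicate; sum-replicate-zero)
import Algebra.Properties.CommutativeSemiring.Binomial +-*-commutativeSemiring as Binomial
open import Algebra.Definitions.RawSemiring +-*-rawSemiring
  using () renaming (_×_ to _×ᴿ_; _^_ to _^ᴿ_)

open import Defs

∑-mono-≤ : ∀ {n} {f g : Vector ℕ n} → (∀ i → f i ≤ g i) → sum f ≤ sum g
∑-mono-≤ {zero}  f≤g = ≤-refl
∑-mono-≤ {suc n} f≤g = +-mono-≤ (f≤g zero) (∑-mono-≤ (f≤g ∘ suc))

∑<n≤∑<1+n : ∀ n (f : ℕ → ℕ) → ∑[ i < n ] f (toℕ i) ≤ ∑[ i < suc n ] f (toℕ i)
∑<n≤∑<1+n zero    f = z≤n
∑<n≤∑<1+n (suc n) f = +-monoʳ-≤ (f 0) (∑<n≤∑<1+n n (f ∘ suc))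

∑-antidiagonal≤∑-square : ∀ M (T : ℕ → ℕ → ℕ) →
  ∑[ j < M ] ∑[ i < suc (toℕ j) ] T (toℕ i) (toℕ j ∸ toℕ i) ≤ ∑[ i < M ] ∑[ l < M ] T (toℕ i) (toℕ l)
∑-antidiagonal≤∑-square zero    T = z≤n
∑-antidiagonal≤∑-square (suc M) T = begin
  (T 0 0 + 0) + ∑[ j < M ] (T 0 (suc (toℕ j)) + ∑[ i < suc (toℕ j) ] T′ (toℕ i) (toℕ j ∸ toℕ i))
    ≡⟨ cong₂ _+_ (+-identityʳ (T 0 0)) (∑-distrib-+ (λ j → T 0 (suc (toℕ j))) antidiagonal′) ⟩
  T 0 0 + (∑[ j < M ] T 0 (suc (toℕ j)) + sum antidiagonal′)
    ≡⟨ +-assoc (T 0 0) (∑[ j < M ] T 0 (suc (toℕ j))) (sum antidiagonal′) ⟨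
  ∑[ l < suc M ] T 0 (toℕ l) + ∑[ j < M ] ∑[ i < suc (toℕ j) ] T′ (toℕ i) (toℕ j ∸ toℕ i)
    ≤⟨ +-monoʳ-≤ (∑[ l < suc M ] T 0 (toℕ l)) (∑-antidiagonal≤∑-square M T′) ⟩
  ∑[ l < suc M ] T 0 (toℕ l) + ∑[ i < M ] ∑[ l < M ] T′ (toℕ i) (toℕ l)
    ≤⟨ +-monoʳ-≤ (∑[ l < suc M ] T 0 (toℕ l)) (∑-mono-≤ {M} (λ i → ∑<n≤∑<1+n M (T′ (toℕ i)))) ⟩
  ∑[ l < suc M ] T 0 (toℕ l) + ∑[ i < M ] ∑[ l < suc M ] T′ (toℕ i) (toℕ l) ∎
  where
  open ≤-Reasoning
  T′ = T ∘ suc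
  antidiagonal′ : Vector ℕ M
  antidiagonal′ j = ∑[ i < suc (toℕ j) ] T′ (toℕ i) (toℕ j ∸ toℕ i)

×ᴿ≡* : ∀ m n → m ×ᴿ n ≡ m * n
×ᴿ≡* zero    n = refl
×ᴿ≡* (suc m) n = cong (n +_) (×ᴿ≡* m n)

^ᴿ≡^ : ∀ m n → m ^ᴿ n ≡ m ^ n
^ᴿ≡^ m zero    = refl
^ᴿ≡^ m (suc n) = cong (m *_) (^ᴿ≡^ m n)

binomial : ∀ n a b → (a + b) ^ n ≡ ∑[ i < suc n ] ((n C toℕ i) * (a ^ toℕ i * b ^ (n ∸ toℕ i)))
binomial n a b = begin
  (a + b) ^ n                ≡⟨ ^ᴿ≡^ (a + b) n ⟨
  (a + b) ^ᴿ n               ≡⟨ Binomial.theorem n a b ⟩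
  Binomial.binomialExpansion a b n
    ≡⟨ sum-cong-≗ term ⟩
  ∑[ i < suc n ] ((n C toℕ i) * (a ^ toℕ i * b ^ (n ∸ toℕ i))) ∎
  where
  open ≡-Reasoning
  term : ∀ (i : Fin (suc n)) → Binomial.binomialTerm a b n i ≡ (n C toℕ i) * (a ^ toℕ i * b ^ (n ∸ toℕ i))
  term i = trans (×ᴿ≡* (n C toℕ i) (a ^ᴿ toℕ i * b ^ᴿ (n ∸ toℕ i)))
                 (cong ((n C toℕ i) *_) (cong₂ _*_ (^ᴿ≡^ a (toℕ i)) (^ᴿ≡^ b (n ∸ toℕ i))))

infix 8 _!/_!
_!/_! : ℕ → ℕ → ℕ
m !/ j ! = (m ! / j !) {{j !≢0}}

[m!/n!]*n!≡m! : ∀ {m n} → n ≤ m → (m !/ n !) * n ! ≡ m !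
[m!/n!]*n!≡m! {n = n} n≤m = m/n*n≡m {{n !≢0}} (m≤n⇒m!∣n! n≤m)

nCk*[k!*[n∸k]!]≡n! : ∀ {n k} → k ≤ n → (n C k) * (k ! * (n ∸ k) !) ≡ n !
nCk*[k!*[n∸k]!]≡n! {n} {k} k≤n =
  trans (cong (_* (k ! * (n ∸ k) !)) (nCk≡n!/k![n-k]! k≤n)) (m/n*n≡m (k![n∸k]!∣n! k≤n))
  where instance _ = k !* (n ∸ k) !≢0

jCi*[m!/j!]*m!≡[m!/i!]*[m!/[j∸i]!] : ∀ {m j i} → i ≤ j → j ≤ m →
  (j C i) * (m !/ j !) * m ! ≡ (m !/ i !) * (m !/ (j ∸ i) !)
jCi*[m!/j!]*m!≡[m!/i!]*[m!/[j∸i]!] {m} {j} {i} i≤j j≤m =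
  *-cancelʳ-≡ _ _ (i ! * (j ∸ i) !) {{i !* (j ∸ i) !≢0}} (begin
    (j C i) * (m !/ j !) * m ! * (i ! * (j ∸ i) !)
      ≡⟨ regroup (j C i) (m !/ j !) (m !) (i ! * (j ∸ i) !) ⟩
    (j C i) * (i ! * (j ∸ i) !) * (m !/ j !) * m !
      ≡⟨ cong (λ z → z * (m !/ j !) * m !) (nCk*[k!*[n∸k]!]≡n! i≤j) ⟩
    j ! * (m !/ j !) * m !
      ≡⟨ cong (_* m !) (trans (*-comm (j !) (m !/ j !)) ([m!/n!]*n!≡m! j≤m)) ⟩
    m ! * m !
      ≡⟨ cong₂ _*_ ([m!/n!]*n!≡m! i≤m) ([m!/n!]*n!≡m! j∸i≤m) ⟨
    (m !/ i !) * i ! * ((m !/ (j ∸ i) !) * (j ∸ i) !)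
      ≡⟨ interchange (m !/ i !) (i !) (m !/ (j ∸ i) !) ((j ∸ i) !) ⟩
    (m !/ i !) * (m !/ (j ∸ i) !) * (i ! * (j ∸ i) !) ∎)
  where
  open ≡-Reasoning
  i≤m = ≤-trans i≤j j≤m
  j∸i≤m = ≤-trans (m∸n≤m j i) j≤m
  regroup : ∀ c p f d → c * p * f * d ≡ c * d * p * f
  regroup = solve-∀
  interchange : ∀ a b c d → a * b * (c * d) ≡ a * c * (b * d)
  interchange = solve-∀

expTerm : ℕ → ℕ → ℕ → ℕ
expTerm m a j = a ^ j * (m !/ j !)

-- (a + b)ʲ / j! = ∑ᵢ aⁱ / i! · bʲ⁻ⁱ / (j - i)!, multiplied through by m!².
binomial-exp : ∀ {m j} a b → j ≤ m →
  (a + b) ^ j * (m !/ j !) * m ! ≡ ∑[ i < suc j ] (expTerm m a (toℕ i) * expTerm m b (j ∸ toℕ i))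
binomial-exp {m} {j} a b j≤m = begin
  (a + b) ^ j * (m !/ j !) * m !
    ≡⟨ trans (*-assoc ((a + b) ^ j) (m !/ j !) (m !)) (cong (_* ((m !/ j !) * m !)) (binomial j a b)) ⟩
  (∑[ i < suc j ] ((j C toℕ i) * (a ^ toℕ i * b ^ (j ∸ toℕ i)))) * ((m !/ j !) * m !)
    ≡⟨ *-distribʳ-sum {suc j} ((m !/ j !) * m !) (λ i → (j C toℕ i) * (a ^ toℕ i * b ^ (j ∸ toℕ i))) ⟩
  ∑[ i < suc j ] ((j C toℕ i) * (a ^ toℕ i * b ^ (j ∸ toℕ i)) * ((m !/ j !) * m !))
    ≡⟨ sum-cong-≗ term ⟩
  ∑[ i < suc j ] (expTerm m a (toℕ i) * expTerm m b (j ∸ toℕ i)) ∎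
  where
  open ≡-Reasoning
  regroup : ∀ c x y p f → c * (x * y) * (p * f) ≡ c * p * f * x * y
  regroup = solve-∀
  interchange : ∀ x y p q → p * q * x * y ≡ x * p * (y * q)
  interchange = solve-∀
  term : ∀ (i : Fin (suc j)) → (j C toℕ i) * (a ^ toℕ i * b ^ (j ∸ toℕ i)) * ((m !/ j !) * m !)
                             ≡ expTerm m a (toℕ i) * expTerm m b (j ∸ toℕ i)
  term i = begin
    (j C toℕ i) * (a ^ toℕ i * b ^ (j ∸ toℕ i)) * ((m !/ j !) * m !)
      ≡⟨ regroup (j C toℕ i) (a ^ toℕ i) (b ^ (j ∸ toℕ i)) (m !/ j !) (m !) ⟩
    (j C toℕ i) * (m !/ j !) * m ! * a ^ toℕ i * b ^ (j ∸ toℕ i)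
      ≡⟨ cong (λ z → z * a ^ toℕ i * b ^ (j ∸ toℕ i)) (jCi*[m!/j!]*m!≡[m!/i!]*[m!/[j∸i]!] (toℕ≤pred[n] i) j≤m) ⟩
    (m !/ toℕ i !) * (m !/ (j ∸ toℕ i) !) * a ^ toℕ i * b ^ (j ∸ toℕ i)
      ≡⟨ interchange (a ^ toℕ i) (b ^ (j ∸ toℕ i)) (m !/ toℕ i !) (m !/ (j ∸ toℕ i) !) ⟩
    expTerm m a (toℕ i) * expTerm m b (j ∸ toℕ i) ∎

sumᴸ-applyUpTo : ∀ n (f g : ℕ → ℕ) → sumᴸ (mapᴸ f (applyUpTo g n)) ≡ ∑[ i < n ] f (g (toℕ i))
sumᴸ-applyUpTo zero    f g = refl
sumᴸ-applyUpTo (suc n) f g = cong (f (g 0) +_) (sumᴸ-applyUpTo n f (g ∘ suc))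

expScaled≡∑ : ∀ a m → expScaled a m ≡ ∑[ j < suc m ] expTerm m a (toℕ j)
expScaled≡∑ a m = sumᴸ-applyUpTo (suc m) (expTerm m a) (λ j → j)

expScaled-monoˡ-≤ : ∀ {a b} m → a ≤ b → expScaled a m ≤ expScaled b m
expScaled-monoˡ-≤ {a} {b} m a≤b = begin
  expScaled a m                        ≡⟨ expScaled≡∑ a m ⟩
  ∑[ j < suc m ] expTerm m a (toℕ j)
    ≤⟨ ∑-mono-≤ {suc m} (λ j → *-monoˡ-≤ (m !/ toℕ j !) (^-monoˡ-≤ (toℕ j) a≤b)) ⟩
  ∑[ j < suc m ] expTerm m b (toℕ j)   ≡⟨ expScaled≡∑ b m ⟨
  expScaled b m                        ∎
  where open ≤-Reasoning

expScaled-0 : ∀ m → expScaled 0 m ≡ m !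
expScaled-0 m = begin
  expScaled 0 m                  ≡⟨ expScaled≡∑ 0 m ⟩
  1 * (m ! / 1) + ∑[ j < m ] 0
    ≡⟨ cong₂ _+_ (trans (*-identityˡ (m ! / 1)) (n/1≡n (m !))) (sum-replicate-zero m) ⟩
  m ! + 0                        ≡⟨ +-identityʳ (m !) ⟩
  m !                            ∎
  where open ≡-Reasoning

expScaled[a+b]*m!≤expScaled[a]*expScaled[b] : ∀ a b m →
  expScaled (a + b) m * m ! ≤ expScaled a m * expScaled b m
expScaled[a+b]*m!≤expScaled[a]*expScaled[b] a b m = begin
  expScaled (a + b) m * m !
    ≡⟨ cong (_* m !) (expScaled≡∑ (a + b) m) ⟩
  (∑[ j < suc m ] expTerm m (a + b) (toℕ j)) * m !
    ≡⟨ *-distribʳ-sum {suc m} (m !) (λ j → expTerm m (a + b) (toℕ j)) ⟩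
  ∑[ j < suc m ] (expTerm m (a + b) (toℕ j) * m !)
    ≡⟨ sum-cong-≗ {suc m} (λ j → binomial-exp a b (toℕ≤pred[n] j)) ⟩
  ∑[ j < suc m ] ∑[ i < suc (toℕ j) ] (expTerm m a (toℕ i) * expTerm m b (toℕ j ∸ toℕ i))
    ≤⟨ ∑-antidiagonal≤∑-square (suc m) (λ i l → expTerm m a i * expTerm m b l) ⟩
  ∑[ i < suc m ] ∑[ l < suc m ] (expTerm m a (toℕ i) * expTerm m b (toℕ l))
    ≡⟨ sum-cong-≗ {suc m} (λ i → *-distribˡ-sum {suc m} (expTerm m a (toℕ i)) (λ l → expTerm m b (toℕ l))) ⟨
  ∑[ i < suc m ] (expTerm m a (toℕ i) * ∑[ l < suc m ] expTerm m b (toℕ l))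
    ≡⟨ *-distribʳ-sum {suc m} (∑[ l < suc m ] expTerm m b (toℕ l)) (λ i → expTerm m a (toℕ i)) ⟨
  (∑[ i < suc m ] expTerm m a (toℕ i)) * (∑[ l < suc m ] expTerm m b (toℕ l))
    ≡⟨ cong₂ _*_ (expScaled≡∑ a m) (expScaled≡∑ b m) ⟨
  expScaled a m * expScaled b m ∎
  where open ≤-Reasoning

LeMulLog-zero : ∀ n → LeMulLog 0 0 n
LeMulLog-zero n m = ≤-reflexive (trans (expScaled-0 m) (sym (*-identityˡ (m !))))

LeMulLog-+ : ∀ {a a′ b b′ n} → LeMulLog a b n → LeMulLog a′ b′ n → LeMulLog (a + a′) (b + b′) n
LeMulLog-+ {a} {a′} {b} {b′} {n} h h′ m = *-cancelʳ-≤ _ _ (m !) {{m !≢0}} (begin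
  expScaled (a + a′) m * m !       ≤⟨ expScaled[a+b]*m!≤expScaled[a]*expScaled[b] a a′ m ⟩
  expScaled a m * expScaled a′ m   ≤⟨ *-mono-≤ (h m) (h′ m) ⟩
  n ^ b * m ! * (n ^ b′ * m !)     ≡⟨ interchange (n ^ b) (m !) (n ^ b′) (m !) ⟩
  n ^ b * n ^ b′ * (m ! * m !)     ≡⟨ cong (_* (m ! * m !)) (^-distribˡ-+-* n b b′) ⟨
  n ^ (b + b′) * (m ! * m !)       ≡⟨ *-assoc (n ^ (b + b′)) (m !) (m !) ⟨
  n ^ (b + b′) * m ! * m !         ∎)
  where
  open ≤-Reasoning
  interchange : ∀ a b c d → a * b * (c * d) ≡ a * c * (b * d)
  interchange = solve-∀

LeMulLog-* : ∀ k {a b n} → LeMulLog a b n → LeMulLog (k * a) (k * b) n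
LeMulLog-* zero    {n = n} h = LeMulLog-zero n
LeMulLog-* (suc k) {a} {b} {n} h = LeMulLog-+ {a} {k * a} {b} {k * b} {n} h (LeMulLog-* k h)

LeMulLog-monoˡ : ∀ {a a′ b n} → a′ ≤ a → LeMulLog a b n → LeMulLog a′ b n
LeMulLog-monoˡ a′≤a h m = ≤-trans (expScaled-monoˡ-≤ m a′≤a) (h m)

LeMulLog-monoʳ : ∀ {a b b′ n} → 1 ≤ n → b ≤ b′ → LeMulLog a b n → LeMulLog a b′ n
LeMulLog-monoʳ {n = n} 1≤n b≤b′ h m = ≤-trans (h m) (*-monoˡ-≤ (m !) (^-monoʳ-≤ n {{>-nonZero 1≤n}} b≤b′))

-- LeSqrtMulLog d c n encodes d ≤ √(c · ln n).
LeSqrtMulLog : ℕ → ℕ → ℕ → Set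
LeSqrtMulLog d c n = LeMulLog (d ^ 2) c n

LeSqrtMulLog-0 : ∀ {c n} → 1 ≤ n → LeSqrtMulLog 0 c n
LeSqrtMulLog-0 {c} {n} 1≤n = LeMulLog-monoʳ {0} {0} {c} {n} 1≤n z≤n (LeMulLog-zero n)

LeSqrtMulLog-monoˡ : ∀ {d d′ c n} → d′ ≤ d → LeSqrtMulLog d c n → LeSqrtMulLog d′ c n
LeSqrtMulLog-monoˡ {c = c} {n} d′≤d = LeMulLog-monoˡ {b = c} {n} (^-monoˡ-≤ 2 d′≤d)

LeSqrtMulLog-+ : ∀ {a b c n} → LeSqrtMulLog a c n → LeSqrtMulLog b c n → LeSqrtMulLog (a + b) (4 * c) n
LeSqrtMulLog-+ {a} {b} {c} {n} ha hb =
  LeMulLog-monoˡ {b = 4 * c} {n} [a+b]²≤4[a⊔b]² (LeMulLog-* 4 {(a ⊔ b) ^ 2} {c} {n} ha⊔b)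
  where
  ha⊔b : LeSqrtMulLog (a ⊔ b) c n
  ha⊔b with ⊔-sel a b
  ... | inj₁ a⊔b≡a = subst (λ d → LeSqrtMulLog d c n) (sym a⊔b≡a) ha
  ... | inj₂ a⊔b≡b = subst (λ d → LeSqrtMulLog d c n) (sym a⊔b≡b) hb
  -- x ^ 2 written out, as the ring solver does not accept _^_.
  [x+x]²≡4x² : ∀ x → (x + x) * ((x + x) * 1) ≡ 4 * (x * (x * 1))
  [x+x]²≡4x² = solve-∀
  [a+b]²≤4[a⊔b]² : (a + b) ^ 2 ≤ 4 * (a ⊔ b) ^ 2
  [a+b]²≤4[a⊔b]² = ≤-trans (^-monoˡ-≤ 2 (+-mono-≤ (m≤m⊔n a b) (m≤n⊔m a b)))
                           (≤-reflexive ([x+x]²≡4x² (a ⊔ b)))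

∣a+b-c+d∣≤∣a-c∣+∣b-d∣ : ∀ a b c d → ∣ a + b - c + d ∣ ≤ ∣ a - c ∣ + ∣ b - d ∣
∣a+b-c+d∣≤∣a-c∣+∣b-d∣ a b c d = begin
  ∣ a + b - c + d ∣                        ≤⟨ ∣-∣-triangle (a + b) (c + b) (c + d) ⟩
  ∣ a + b - c + b ∣ + ∣ c + b - c + d ∣    ≡⟨ cong₂ _+_ ∣a+b-c+b∣≡∣a-c∣ (∣m+n-m+o∣≡∣n-o∣ c b d) ⟩
  ∣ a - c ∣ + ∣ b - d ∣                    ∎
  where
  open ≤-Reasoning
  ∣a+b-c+b∣≡∣a-c∣ : ∣ a + b - c + b ∣ ≡ ∣ a - c ∣
  ∣a+b-c+b∣≡∣a-c∣ = trans (cong₂ ∣_-_∣ (+-comm a b) (+-comm c b)) (∣m+n-m+o∣≡∣n-o∣ b a c)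

∣a-b∣≡∣c-d∣ : ∀ {a b c d} → a + d ≡ b + c → ∣ a - b ∣ ≡ ∣ c - d ∣
∣a-b∣≡∣c-d∣ {a} {b} {c} {d} a+d≡b+c = begin
  ∣ a - b ∣              ≡⟨ ∣m+n-m+o∣≡∣n-o∣ d a b ⟨
  ∣ d + a - d + b ∣      ≡⟨ cong₂ ∣_-_∣ (trans (+-comm d a) a+d≡b+c) (+-comm d b) ⟩
  ∣ b + c - b + d ∣      ≡⟨ ∣m+n-m+o∣≡∣n-o∣ b c d ⟩
  ∣ c - d ∣              ∎
  where open ≡-Reasoning

-- ∑⁺ f and ∑ₛ f sum f over the nonempty, respectively all, subsets of Fin k.
∑⁺ : ∀ {k} → (Subset k → ℕ) → ℕ
∑ₛ : ∀ {k} → (Subset k → ℕ) → ℕ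

∑⁺ {zero}  f = 0
∑⁺ {suc k} f = ∑⁺ (f ∘ (outside ∷_)) + ∑ₛ (f ∘ (inside ∷_))

∑ₛ f = f ⊥ + ∑⁺ f

∑ₛ-split : ∀ {k} (f : Subset (suc k) → ℕ) → ∑ₛ f ≡ ∑ₛ (f ∘ (outside ∷_)) + ∑ₛ (f ∘ (inside ∷_))
∑ₛ-split f = sym (+-assoc (f ⊥) (∑⁺ (f ∘ (outside ∷_))) (∑ₛ (f ∘ (inside ∷_))))

∑ₛ-cong : ∀ {k} {f g : Subset k → ℕ} → (∀ S → f S ≡ g S) → ∑ₛ f ≡ ∑ₛ g
∑ₛ-cong {zero}          f≗g = cong (_+ 0) (f≗g [])
∑ₛ-cong {suc k} {f} {g} f≗g = begin
  ∑ₛ f                                           ≡⟨ ∑ₛ-split f ⟩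
  ∑ₛ (f ∘ (outside ∷_)) + ∑ₛ (f ∘ (inside ∷_))
    ≡⟨ cong₂ _+_ (∑ₛ-cong (f≗g ∘ (outside ∷_))) (∑ₛ-cong (f≗g ∘ (inside ∷_))) ⟩
  ∑ₛ (g ∘ (outside ∷_)) + ∑ₛ (g ∘ (inside ∷_))   ≡⟨ ∑ₛ-split g ⟨
  ∑ₛ g                                           ∎
  where open ≡-Reasoning

∑-∑ₛ-comm : ∀ {k n} (g : Subset k → Fin n → ℕ) → ∑[ i < n ] ∑ₛ (λ S → g S i) ≡ ∑ₛ (λ S → ∑[ i < n ] g S i)
∑-∑ₛ-comm {zero}  {n} g = trans (∑-distrib-+ (g []) (λ _ → 0)) (cong (sum (g []) +_) (sum-replicate-zero n))
∑-∑ₛ-comm {suc k} {n} g = begin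
  ∑[ i < n ] ∑ₛ (λ S → g S i)
    ≡⟨ sum-cong-≗ (λ i → ∑ₛ-split (λ S → g S i)) ⟩
  ∑[ i < n ] (∑ₛ (λ S → g₀ S i) + ∑ₛ (λ S → g₁ S i))
    ≡⟨ ∑-distrib-+ (λ i → ∑ₛ (λ S → g₀ S i)) (λ i → ∑ₛ (λ S → g₁ S i)) ⟩
  ∑[ i < n ] ∑ₛ (λ S → g₀ S i) + ∑[ i < n ] ∑ₛ (λ S → g₁ S i)
    ≡⟨ cong₂ _+_ (∑-∑ₛ-comm g₀) (∑-∑ₛ-comm g₁) ⟩
  ∑ₛ (λ S → ∑[ i < n ] g₀ S i) + ∑ₛ (λ S → ∑[ i < n ] g₁ S i)
    ≡⟨ ∑ₛ-split (λ S → ∑[ i < n ] g S i) ⟨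
  ∑ₛ (λ S → ∑[ i < n ] g S i) ∎
  where
  open ≡-Reasoning
  g₀ g₁ : Subset k → Fin n → ℕ
  g₀ = g ∘ (outside ∷_)
  g₁ = g ∘ (inside ∷_)

∑ₛ-LeSqrtMulLog : ∀ {k c n} (f : Subset k → ℕ) →
  (∀ S → LeSqrtMulLog (f S) c n) → LeSqrtMulLog (∑ₛ f) (4 ^ k * c) n
∑ₛ-LeSqrtMulLog {zero} {c} {n} f h =
  subst₂ (λ d c′ → LeSqrtMulLog d c′ n) (sym (+-identityʳ (f []))) (sym (*-identityˡ c)) (h [])
∑ₛ-LeSqrtMulLog {suc k} {c} {n} f h =
  subst₂ (λ d c′ → LeSqrtMulLog d c′ n) (sym (∑ₛ-split f)) (sym (*-assoc 4 (4 ^ k) c))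
    (LeSqrtMulLog-+ {∑ₛ (f ∘ (outside ∷_))} {∑ₛ (f ∘ (inside ∷_))} {4 ^ k * c} {n}
      (∑ₛ-LeSqrtMulLog (f ∘ (outside ∷_)) (h ∘ (outside ∷_)))
      (∑ₛ-LeSqrtMulLog (f ∘ (inside ∷_)) (h ∘ (inside ∷_))))

∑⁺-LeSqrtMulLog : ∀ {k c n} → 1 ≤ n → (f : Subset k → ℕ) →
  (∀ S → Nonempty S → LeSqrtMulLog (f S) c n) → LeSqrtMulLog (∑⁺ f) (4 ^ k * c) n
∑⁺-LeSqrtMulLog {zero}  {c}     1≤n f h = LeSqrtMulLog-0 {1 * c} 1≤n
∑⁺-LeSqrtMulLog {suc k} {c} {n} 1≤n f h =
  subst (λ c′ → LeSqrtMulLog (∑⁺ f) c′ n) (sym (*-assoc 4 (4 ^ k) c))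
    (LeSqrtMulLog-+ {∑⁺ (f ∘ (outside ∷_))} {∑ₛ (f ∘ (inside ∷_))} {4 ^ k * c} {n}
      (∑⁺-LeSqrtMulLog 1≤n (f ∘ (outside ∷_)) (λ S (j , j∈S) → h (outside ∷ S) (suc j , there j∈S)))
      (∑ₛ-LeSqrtMulLog (f ∘ (inside ∷_)) (λ S → h (inside ∷ S) (zero , here))))

∣∑⁺-∑⁺∣≤∑⁺∣-∣ : ∀ {k} (p q : Subset k → ℕ) → ∣ ∑⁺ p - ∑⁺ q ∣ ≤ ∑⁺ (λ S → ∣ p S - q S ∣)
∣∑⁺-∑⁺∣≤∑⁺∣-∣ {zero}  p q = ≤-refl
∣∑⁺-∑⁺∣≤∑⁺∣-∣ {suc k} p q = begin
  ∣ ∑⁺ p₀ + (p₁ ⊥ + ∑⁺ p₁) - ∑⁺ q₀ + (q₁ ⊥ + ∑⁺ q₁) ∣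
    ≤⟨ ∣a+b-c+d∣≤∣a-c∣+∣b-d∣ (∑⁺ p₀) (p₁ ⊥ + ∑⁺ p₁) (∑⁺ q₀) (q₁ ⊥ + ∑⁺ q₁) ⟩
  ∣ ∑⁺ p₀ - ∑⁺ q₀ ∣ + ∣ p₁ ⊥ + ∑⁺ p₁ - q₁ ⊥ + ∑⁺ q₁ ∣
    ≤⟨ +-monoʳ-≤ ∣ ∑⁺ p₀ - ∑⁺ q₀ ∣ (∣a+b-c+d∣≤∣a-c∣+∣b-d∣ (p₁ ⊥) (∑⁺ p₁) (q₁ ⊥) (∑⁺ q₁)) ⟩
  ∣ ∑⁺ p₀ - ∑⁺ q₀ ∣ + (∣ p₁ ⊥ - q₁ ⊥ ∣ + ∣ ∑⁺ p₁ - ∑⁺ q₁ ∣)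
    ≤⟨ +-mono-≤ (∣∑⁺-∑⁺∣≤∑⁺∣-∣ p₀ q₀) (+-monoʳ-≤ ∣ p₁ ⊥ - q₁ ⊥ ∣ (∣∑⁺-∑⁺∣≤∑⁺∣-∣ p₁ q₁)) ⟩
  ∑⁺ (λ S → ∣ p S - q S ∣) ∎
  where
  open ≤-Reasoning
  p₀ p₁ q₀ q₁ : Subset k → ℕ
  p₀ = p ∘ (outside ∷_)
  p₁ = p ∘ (inside ∷_)
  q₀ = q ∘ (outside ∷_)
  q₁ = q ∘ (inside ∷_)

𝟙 : Bool → ℕ
𝟙 true  = 1
𝟙 false = 0

∣tabulate∣≡∑𝟙 : ∀ {n} (g : Fin n → Bool) → ∣ tabulate g ∣ ≡ ∑[ i < n ] 𝟙 (g i)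
∣tabulate∣≡∑𝟙 {zero}  g = refl
∣tabulate∣≡∑𝟙 {suc n} g with g zero
... | true  = cong suc (∣tabulate∣≡∑𝟙 (g ∘ suc))
... | false = ∣tabulate∣≡∑𝟙 (g ∘ suc)

∑𝟙∘not+∑𝟙≡n : ∀ {n} (g : Fin n → Bool) → ∑[ i < n ] 𝟙 (not (g i)) + ∑[ i < n ] 𝟙 (g i) ≡ n
∑𝟙∘not+∑𝟙≡n {zero}  g = refl
∑𝟙∘not+∑𝟙≡n {suc n} g with g zero
... | true  = trans (+-suc _ _) (cong suc (∑𝟙∘not+∑𝟙≡n (g ∘ suc)))
... | false = cong suc (∑𝟙∘not+∑𝟙≡n (g ∘ suc))

∣∑𝟙∘not-∑𝟙∣≡∣2∑𝟙-n∣ : ∀ {n} (g : Fin n → Bool) →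
  ∣ ∑[ i < n ] 𝟙 (not (g i)) - ∑[ i < n ] 𝟙 (g i) ∣ ≡ ∣ 2 * ∑[ i < n ] 𝟙 (g i) - n ∣
∣∑𝟙∘not-∑𝟙∣≡∣2∑𝟙-n∣ {n} g = begin
  ∣ u′ - u ∣        ≡⟨ ∣a-b∣≡∣c-d∣ {u′} {u} {n} {2 * u} (trans (rearrange u′ u) (cong (u +_) (∑𝟙∘not+∑𝟙≡n g))) ⟩
  ∣ n - 2 * u ∣     ≡⟨ ∣-∣-comm n (2 * u) ⟩
  ∣ 2 * u - n ∣     ∎
  where
  open ≡-Reasoning
  u u′ : ℕ
  u = ∑[ i < n ] 𝟙 (g i)
  u′ = ∑[ i < n ] 𝟙 (not (g i))
  rearrange : ∀ x y → x + 2 * y ≡ y + (x + y)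
  rearrange = solve-∀

∣∑𝟙∘not∘xor-∑𝟙∘xor∣≡∣2∑𝟙-n∣ : ∀ {n} (g : Fin n → Bool) c →
  ∣ ∑[ i < n ] 𝟙 (not (g i xor c)) - ∑[ i < n ] 𝟙 (g i xor c) ∣ ≡ ∣ 2 * ∑[ i < n ] 𝟙 (g i) - n ∣
∣∑𝟙∘not∘xor-∑𝟙∘xor∣≡∣2∑𝟙-n∣ g false = trans
  (cong₂ ∣_-_∣ (sum-cong-≗ (cong (𝟙 ∘ not) ∘ xor-identityʳ ∘ g)) (sum-cong-≗ (cong 𝟙 ∘ xor-identityʳ ∘ g)))
  (∣∑𝟙∘not-∑𝟙∣≡∣2∑𝟙-n∣ g)
∣∑𝟙∘not∘xor-∑𝟙∘xor∣≡∣2∑𝟙-n∣ {n} g true = begin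
  ∣ ∑[ i < n ] 𝟙 (not (g i xor true)) - ∑[ i < n ] 𝟙 (g i xor true) ∣
    ≡⟨ cong₂ ∣_-_∣
         (sum-cong-≗ (λ i → trans (cong (𝟙 ∘ not) (xor-comm (g i) true)) (cong 𝟙 (not-involutive (g i)))))
         (sum-cong-≗ (λ i → cong 𝟙 (xor-comm (g i) true))) ⟩
  ∣ ∑[ i < n ] 𝟙 (g i) - ∑[ i < n ] 𝟙 (not (g i)) ∣
    ≡⟨ ∣-∣-comm (∑[ i < n ] 𝟙 (g i)) (∑[ i < n ] 𝟙 (not (g i))) ⟩
  ∣ ∑[ i < n ] 𝟙 (not (g i)) - ∑[ i < n ] 𝟙 (g i) ∣
    ≡⟨ ∣∑𝟙∘not-∑𝟙∣≡∣2∑𝟙-n∣ g ⟩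
  ∣ 2 * ∑[ i < n ] 𝟙 (g i) - n ∣ ∎
  where open ≡-Reasoning

infix 7 _·_
_·_ : ∀ {k} → Subset k → (Fin k → Bool) → Bool
[]      · b = false
(s ∷ S) · b = (s ∧ b zero) xor (S · (b ∘ suc))

isZero : ∀ {k} → (Fin k → Bool) → Bool
isZero {zero}  b = true
isZero {suc k} b = not (b zero) ∧ isZero (b ∘ suc)

⊥·b≡false : ∀ {k} (b : Fin k → Bool) → ⊥ · b ≡ false
⊥·b≡false {zero}  b = refl
⊥·b≡false {suc k} b = ⊥·b≡false (b ∘ suc)

·-distrib-xor : ∀ {k} (S : Subset k) (b c : Fin k → Bool) → S · (λ j → b j xor c j) ≡ (S · b) xor (S · c)
·-distrib-xor []            b c = refl
·-distrib-xor (outside ∷ S) b c = ·-distrib-xor S (b ∘ suc) (c ∘ suc)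
·-distrib-xor (inside ∷ S)  b c = trans (cong ((b zero xor c zero) xor_) (·-distrib-xor S (b ∘ suc) (c ∘ suc)))
                                        (xor-interchange (b zero) (c zero) (S · (b ∘ suc)) (S · (c ∘ suc)))

-- ∑_S (-1)^(S · b) = 2ᵏ [b = 0], with the negative terms moved to the right.
∑ₛ-character : ∀ {k} (b : Fin k → Bool) →
  ∑ₛ (λ S → 𝟙 (not (S · b))) ≡ ∑ₛ (λ S → 𝟙 (S · b)) + 2 ^ k * 𝟙 (isZero b)
∑ₛ-character {zero}  b = refl
∑ₛ-character {suc k} b = begin
  ∑ₛ (λ S → 𝟙 (not (S · b)))
    ≡⟨ ∑ₛ-split (λ S → 𝟙 (not (S · b))) ⟩
  N + ∑ₛ (λ S → 𝟙 (not (b zero xor S · b′)))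
    ≡⟨ halves (b zero) ⟩
  P + ∑ₛ (λ S → 𝟙 (b zero xor S · b′)) + 2 ^ suc k * 𝟙 (isZero b)
    ≡⟨ cong (_+ 2 ^ suc k * 𝟙 (isZero b)) (∑ₛ-split (λ S → 𝟙 (S · b))) ⟨
  ∑ₛ (λ S → 𝟙 (S · b)) + 2 ^ suc k * 𝟙 (isZero b) ∎
  where
  open ≡-Reasoning
  b′ : Fin k → Bool
  b′ = b ∘ suc
  N P z : ℕ
  N = ∑ₛ (λ S → 𝟙 (not (S · b′)))
  P = ∑ₛ (λ S → 𝟙 (S · b′))
  z = 𝟙 (isZero b′)
  double : ∀ P x z → (P + x * z) + (P + x * z) ≡ P + P + 2 * x * z
  double = solve-∀
  halves : ∀ c → N + ∑ₛ (λ S → 𝟙 (not (c xor S · b′)))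
                 ≡ P + ∑ₛ (λ S → 𝟙 (c xor S · b′)) + 2 ^ suc k * 𝟙 (not c ∧ isZero b′)
  halves false = begin
    N + N                               ≡⟨ cong₂ _+_ (∑ₛ-character b′) (∑ₛ-character b′) ⟩
    (P + 2 ^ k * z) + (P + 2 ^ k * z)   ≡⟨ double P (2 ^ k) z ⟩
    P + P + 2 ^ suc k * z               ∎
  halves true = begin
    N + ∑ₛ (λ S → 𝟙 (not (not (S · b′))))   ≡⟨ cong (N +_) (∑ₛ-cong (λ S → cong 𝟙 (not-involutive (S · b′)))) ⟩
    N + P                                   ≡⟨ +-comm N P ⟩
    P + N                                   ≡⟨ +-identityʳ (P + N) ⟨
    P + N + 0                               ≡⟨ cong (P + N +_) (*-zeroʳ (2 ^ suc k)) ⟨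
    P + N + 2 ^ suc k * 0                   ∎

xorFold≡· : ∀ {k n} (S : Subset k) (B : Fin k → Subset n) i → xorFold S B i ≡ S · (λ j → lookup (B j) i)
xorFold≡· []      B i = refl
xorFold≡· (s ∷ S) B i = cong ((s ∧ lookup (B zero) i) xor_)
  (trans (cong (λ T → xorFold T (B ∘ suc) i) (tabulate∘lookup S)) (xorFold≡· S (B ∘ suc) i))

mismatch : ∀ {k n} → (Fin k → Subset n) → (Fin k → Bool) → Fin n → Fin k → Bool
mismatch B x i j = lookup (B j) i xor x j

memAll≡isZero∘mismatch : ∀ {k n} (B : Fin k → Subset n) x i → memAll B x i ≡ isZero (mismatch B x i)
memAll≡isZero∘mismatch {zero}  B x i = refl
memAll≡isZero∘mismatch {suc k} B x i =
  cong (not (mismatch B x i zero) ∧_) (memAll≡isZero∘mismatch (B ∘ suc) (x ∘ suc) i)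

module _ {k n} (B : Fin k → Subset n) (x : Fin k → Bool) where

  evenRows oddRows : Subset k → ℕ
  evenRows S = ∑[ i < n ] 𝟙 (not (S · mismatch B x i))
  oddRows  S = ∑[ i < n ] 𝟙 (S · mismatch B x i)

  ∣Ix∣≡∑𝟙[isZero∘mismatch] : ∣ Ix B x ∣ ≡ ∑[ i < n ] 𝟙 (isZero (mismatch B x i))
  ∣Ix∣≡∑𝟙[isZero∘mismatch] =
    trans (∣tabulate∣≡∑𝟙 (memAll B x)) (sum-cong-≗ (cong 𝟙 ∘ memAll≡isZero∘mismatch B x))

  ∑ₛevenRows≡∑ₛoddRows+2^k∣Ix∣ : ∑ₛ evenRows ≡ ∑ₛ oddRows + 2 ^ k * ∣ Ix B x ∣
  ∑ₛevenRows≡∑ₛoddRows+2^k∣Ix∣ = begin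
    ∑ₛ evenRows
      ≡⟨ ∑-∑ₛ-comm (λ S i → 𝟙 (not (S · mismatch B x i))) ⟨
    ∑[ i < n ] ∑ₛ (λ S → 𝟙 (not (S · mismatch B x i)))
      ≡⟨ sum-cong-≗ (∑ₛ-character ∘ mismatch B x) ⟩
    ∑[ i < n ] (∑ₛ (λ S → 𝟙 (S · mismatch B x i)) + 2 ^ k * 𝟙 (isZero (mismatch B x i)))
      ≡⟨ ∑-distrib-+ (λ i → ∑ₛ (λ S → 𝟙 (S · mismatch B x i))) (λ i → 2 ^ k * 𝟙 (isZero (mismatch B x i))) ⟩
    ∑[ i < n ] ∑ₛ (λ S → 𝟙 (S · mismatch B x i)) + ∑[ i < n ] (2 ^ k * 𝟙 (isZero (mismatch B x i)))
      ≡⟨ cong₂ _+_ (∑-∑ₛ-comm (λ S i → 𝟙 (S · mismatch B x i)))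
                   (sym (*-distribˡ-sum (2 ^ k) (λ i → 𝟙 (isZero (mismatch B x i))))) ⟩
    ∑ₛ oddRows + 2 ^ k * ∑[ i < n ] 𝟙 (isZero (mismatch B x i))
      ≡⟨ cong (λ m → ∑ₛ oddRows + 2 ^ k * m) ∣Ix∣≡∑𝟙[isZero∘mismatch] ⟨
    ∑ₛ oddRows + 2 ^ k * ∣ Ix B x ∣ ∎
    where open ≡-Reasoning

  ∣evenRows-oddRows∣≡∣2∣symDiff∣-n∣ : ∀ S → ∣ evenRows S - oddRows S ∣ ≡ ∣ 2 * ∣ symDiff S B ∣ - n ∣
  ∣evenRows-oddRows∣≡∣2∣symDiff∣-n∣ S = begin
    ∣ evenRows S - oddRows S ∣
      ≡⟨ cong₂ ∣_-_∣ (sum-cong-≗ (cong (𝟙 ∘ not) ∘ S·mismatch≡)) (sum-cong-≗ (cong 𝟙 ∘ S·mismatch≡)) ⟩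
    ∣ ∑[ i < n ] 𝟙 (not (xorFold S B i xor S · x)) - ∑[ i < n ] 𝟙 (xorFold S B i xor S · x) ∣
      ≡⟨ ∣∑𝟙∘not∘xor-∑𝟙∘xor∣≡∣2∑𝟙-n∣ (xorFold S B) (S · x) ⟩
    ∣ 2 * ∑[ i < n ] 𝟙 (xorFold S B i) - n ∣
      ≡⟨ cong (λ m → ∣ 2 * m - n ∣) (∣tabulate∣≡∑𝟙 (xorFold S B)) ⟨
    ∣ 2 * ∣ symDiff S B ∣ - n ∣ ∎
    where
    open ≡-Reasoning
    S·mismatch≡ : ∀ i → S · mismatch B x i ≡ xorFold S B i xor S · x
    S·mismatch≡ i = trans (·-distrib-xor S (λ j → lookup (B j) i) x) (cong (_xor S · x) (sym (xorFold≡· S B i)))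

  ∣2^k∣Ix∣-n∣≤∑⁺∣evenRows-oddRows∣ : ∣ 2 ^ k * ∣ Ix B x ∣ - n ∣ ≤ ∑⁺ (λ S → ∣ evenRows S - oddRows S ∣)
  ∣2^k∣Ix∣-n∣≤∑⁺∣evenRows-oddRows∣ = begin
    ∣ 2 ^ k * ∣ Ix B x ∣ - n ∣                ≡⟨ ∣a-b∣≡∣c-d∣ {2 ^ k * ∣ Ix B x ∣} {n} balance ⟩
    ∣ ∑⁺ evenRows - ∑⁺ oddRows ∣              ≤⟨ ∣∑⁺-∑⁺∣≤∑⁺∣-∣ evenRows oddRows ⟩
    ∑⁺ (λ S → ∣ evenRows S - oddRows S ∣)     ∎
    where
    open ≤-Reasoning
    oddRows⊥≡0 : oddRows ⊥ ≡ 0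
    oddRows⊥≡0 = trans (sum-cong-≗ (cong 𝟙 ∘ ⊥·b≡false ∘ mismatch B x)) (sum-replicate-zero n)
    evenRows⊥≡n : evenRows ⊥ ≡ n
    evenRows⊥≡n = trans (sum-cong-≗ (cong (𝟙 ∘ not) ∘ ⊥·b≡false ∘ mismatch B x))
                        (trans (sum-replicate n) (trans (×ᴿ≡* n 1) (*-identityʳ n)))
    balance : 2 ^ k * ∣ Ix B x ∣ + ∑⁺ oddRows ≡ n + ∑⁺ evenRows
    balance = begin-equality
      2 ^ k * ∣ Ix B x ∣ + ∑⁺ oddRows          ≡⟨ +-comm (2 ^ k * ∣ Ix B x ∣) (∑⁺ oddRows) ⟩
      ∑⁺ oddRows + 2 ^ k * ∣ Ix B x ∣          ≡⟨ cong (λ m → m + ∑⁺ oddRows + 2 ^ k * ∣ Ix B x ∣) oddRows⊥≡0 ⟨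
      ∑ₛ oddRows + 2 ^ k * ∣ Ix B x ∣          ≡⟨ ∑ₛevenRows≡∑ₛoddRows+2^k∣Ix∣ ⟨
      ∑ₛ evenRows                              ≡⟨ cong (_+ ∑⁺ evenRows) evenRows⊥≡n ⟩
      n + ∑⁺ evenRows                          ∎

4^[1+k]*[4*n]≤16^[1+k]*n : ∀ k n → 4 ^ suc k * (4 * n) ≤ 16 ^ suc k * n
4^[1+k]*[4*n]≤16^[1+k]*n k n = begin
  4 ^ suc k * (4 * n)   ≡⟨ regroup (4 ^ k) n ⟩
  16 * 4 ^ k * n        ≤⟨ *-monoˡ-≤ n (*-monoʳ-≤ 16 (^-monoˡ-≤ k (s≤s (s≤s (s≤s (s≤s z≤n)))))) ⟩
  16 * 16 ^ k * n       ∎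
  where
  open ≤-Reasoning
  regroup : ∀ y n → 4 * y * (4 * n) ≡ 16 * y * n
  regroup = solve-∀

lemma7 : (k : ℕ) → 1 ≤ k → ∃[ N ] ((n : ℕ) → N ≤ n →
           (B : Fin k → Subset n) → Simple B →
           (x : Fin k → Bool) →
           LeMulLog (∣ 2 ^ k * ∣ Ix B x ∣ - n ∣ ^ 2) (16 ^ k * n) n)
lemma7 (suc k) _ = 1 , bound
  where
  bound : (n : ℕ) → 1 ≤ n → (B : Fin (suc k) → Subset n) → Simple B → (x : Fin (suc k) → Bool) →
          LeSqrtMulLog ∣ 2 ^ suc k * ∣ Ix B x ∣ - n ∣ (16 ^ suc k * n) n
  bound n 1≤n B simple x =
    LeMulLog-monoʳ 1≤n (4^[1+k]*[4*n]≤16^[1+k]*n k n)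
      (LeSqrtMulLog-monoˡ {c = 4 ^ suc k * (4 * n)} {n} (∣2^k∣Ix∣-n∣≤∑⁺∣evenRows-oddRows∣ B x)
        (∑⁺-LeSqrtMulLog 1≤n (λ S → ∣ evenRows B x S - oddRows B x S ∣) balanced))
    where
    balanced : ∀ S → Nonempty S → LeSqrtMulLog ∣ evenRows B x S - oddRows B x S ∣ (4 * n) n
    balanced S S≢⊥ = subst (λ d → LeSqrtMulLog d (4 * n) n)
                           (sym (∣evenRows-oddRows∣≡∣2∣symDiff∣-n∣ B x S)) (simple S S≢⊥)
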